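{- Let $\lambda$ be a partition. Then $s_\lambda$ is F-multiplicity free if and only if $s_{\lambda^t}$ is F-multiplicity free.
   Context: $\lambda^t$ is the transpose (conjugate) partition. For a composition $\alpha\vDash n$, $\mathrm{set}(\alpha)=\{\alpha_1,\alpha_1+\alpha_2,\dots,\alpha_1+\cdots+\alpha_{k-1}\}$ and $F_\alpha=\sum x_{i_1}\cdots x_{i_n}$ over $i_1\le\cdots\le i_n$ with $i_j<i_{j+1}$ whenever $j\in\mathrm{set}(\alpha)$. A standard Young tableau (SYT) of shape $\lambda\vdash n$ is a filling of the Young diagram with $1,\dots,n$ increasing along rows and down columns; its descent set is the set of $i$ with $i+1$ in a strictly lower row than $i$, and $\mathrm{com}(T)$ is the composition with this set. The Schur function is $s_\lambda=\sum_T F_{\mathrm{com}(T)}$ over SYT $T$ of shape $\lambda$. A quasisymmetric function $\sum c_\alpha F_\alpha$ is F-multiplicity free if all $c_\alpha\in\{0,1\}$. -}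

module Defs where

open import Data.Nat using (ℕ; zero; suc; _+_; _∸_; _<_; _≤_; _≥_; _≟_; _<?_; _≤?_)
open import Data.List using (List; []; _∷_; _++_; map; length; filter; concat; upTo)
open import Data.Nat.ListAction using (sum)
open import Data.Bool.ListAction using (any)
open import Data.List.Relation.Unary.All using (All)
open import Data.List.Relation.Unary.Linked using (Linked)
open import Data.List.Relation.Binary.Permutation.Propositional using (_↭_)
open import Data.Product using (_×_)
open import Data.Unit using (⊤)
open import Data.Empty using (⊥)
open import Data.Bool using (if_then_else_)
open import Relation.Nullary.Decidable using (⌊_⌋)
open import Relation.Binary.PropositionalEquality using (_≡_)

IsPartition : List ℕ → Set
IsPartition λs = Linked _≥_ λs × All (λ x → 0 < x) λs

conj : List ℕ → List ℕ
conj [] = []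
conj (a ∷ λs) = map (λ j → length (filter (λ x → suc j ≤? x) (a ∷ λs))) (upTo a)

-- Tableau: list of rows (top row first), each row a list of entries.
ColOK : List ℕ → List ℕ → Set
ColOK _ [] = ⊤
ColOK [] (_ ∷ _) = ⊥
ColOK (a ∷ as) (b ∷ bs) = (a < b) × ColOK as bs

record SYT (λs : List ℕ) (T : List (List ℕ)) : Set where
  field
    shape   : map length T ≡ λs
    rowsInc : All (Linked _<_) T
    colsInc : Linked ColOK T
    entries : concat T ↭ map suc (upTo (sum λs))

rowOf : List (List ℕ) → ℕ → ℕ
rowOf [] k = 0
rowOf (r ∷ rs) k = if any (λ x → ⌊ k ≟ x ⌋) r then 0 else suc (rowOf rs k)

size : List (List ℕ) → ℕ
size T = length (concat T)

Des : List (List ℕ) → List ℕ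
Des T = filter (λ i → rowOf T i <? rowOf T (suc i)) (map suc (upTo (size T ∸ 1)))

setToComp : ℕ → List ℕ → ℕ → List ℕ
setToComp prev [] n = (n ∸ prev) ∷ []
setToComp prev (d ∷ ds) n = (d ∸ prev) ∷ setToComp d ds n

com : List (List ℕ) → List ℕ
com T = setToComp 0 (Des T) (size T)

-- s_λ = Σ_T F_{com T}; the coefficient of F_α is the number of SYT T of shape λ
-- with com T = α.
FMultFree : List ℕ → Set
FMultFree λs = ∀ (α : List ℕ) (T T′ : List (List ℕ)) →
  SYT λs T → SYT λs T′ → com T ≡ α → com T′ ≡ α → T ≡ T′

-- Transposition T ↦ Tᵗ is a bijection from standard Young tableaux of shape λ
-- to those of shape λᵗ. If i + 1 lies strictly below i in T then it lies weakly
-- left of i, and otherwise it lies strictly right of i; so i is a descent of Tᵗ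
-- exactly when it is not a descent of T. The descent set of Tᵗ is therefore the
-- complement of that of T in {1, …, n − 1}, and T, T′ have the same composition
-- iff Tᵗ, T′ᵗ do: the coefficient of F_α in s_λ is that of F_αᶜ in s_λᵗ.
module Submission where

open import Defs
open import Data.Nat using (ℕ)
open import Data.List using (List)
open import Function.Bundles using (_⇔_)

open import Data.Nat using (zero; suc; _+_; _∸_; _<_; _≤_; _≥_; _≟_; _<?_; _≤?_; _<ᵇ_; z≤n; s≤s; s≤s⁻¹)
open import Data.Nat.Properties
open import Data.Nat.ListAction using (sum)
open import Data.Bool using (true; false)
open import Data.Bool.ListAction using (any)
open import Data.List using ([]; _∷_; _++_; map; length; filter; concat; upTo; applyUpTo; replicate)
open import Data.List.Properties using (map-upTo; map-cong; length-++; length-replicate; ∷-injective)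
open import Data.List.Membership.Propositional using (_∈_; _∉_)
open import Data.List.Membership.Propositional.Properties
  using (∈-concat⁺′; ∈-concat⁻′; ∈-++⁺ʳ; ∈-filter⁺; ∈-filter⁻; ∈-upTo⁺; ∈-upTo⁻; ∈-map⁺; ∈-map⁻)
open import Data.List.Relation.Unary.Any using (here; there)
open import Data.List.Relation.Unary.All using (All; []; _∷_)
import Data.List.Relation.Unary.All as All
import Data.List.Relation.Unary.All.Properties as AllP
open import Data.List.Relation.Unary.AllPairs using (_∷_)
open import Data.List.Relation.Unary.Linked using (Linked; []; [-]; _∷_)
import Data.List.Relation.Unary.Linked as Linked
import Data.List.Relation.Unary.Linked.Properties as LinkedP
open import Data.List.Relation.Unary.Unique.Propositional using (Unique)
import Data.List.Relation.Unary.Unique.Propositional.Properties as UniqueP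
open import Data.List.Relation.Binary.Permutation.Propositional using (_↭_; prep; ↭-refl; ↭-sym; ↭-trans; ↭⇒↭ₛ)
open import Data.List.Relation.Binary.Permutation.Propositional.Properties using (++⁺ˡ; shifts; ↭-length; ∈-resp-↭)
import Data.List.Relation.Binary.Permutation.Setoid.Properties as PermutationSetoid
open import Data.Product using (∃-syntax; _×_; _,_; proj₂; map₁; map₂)
import Data.Product as Product
open import Data.Sum using (inj₁; inj₂)
open import Data.Empty using (⊥)
open import Data.Unit using (⊤; tt)
open import Function using (id; _∘_)
open import Function.Bundles using (mk⇔; Equivalence)
import Function.Properties.Equivalence as ⇔
open import Relation.Nullary using (¬_; yes; no; contradiction)
open import Relation.Nullary.Decidable using (⌊_⌋)
open import Relation.Unary using (Decidable)
open import Relation.Binary.PropositionalEquality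
open import Relation.Binary.PropositionalEquality.Properties using (setoid)

private variable
  A : Set
  r : List A
  T : List (List A)
  i j k : ℕ

-- Positions in lists and tableaux

infix 4 _[_]=_ _[_][_]=_

data _[_]=_ {A : Set} : List A → ℕ → A → Set where
  here  : ∀ {x xs} → (x ∷ xs) [ 0 ]= x
  there : ∀ {x xs j y} → xs [ j ]= y → (x ∷ xs) [ suc j ]= y

there⁻ : ∀ {x y : A} {xs} → (x ∷ xs) [ suc j ]= y → xs [ j ]= y
there⁻ (there p) = p

[]=-functional : ∀ {x y : A} → r [ j ]= x → r [ j ]= y → x ≡ y
[]=-functional here      here      = refl
[]=-functional (there p) (there q) = []=-functional p q

[]=⇒∈ : ∀ {x : A} → r [ j ]= x → x ∈ r
[]=⇒∈ here      = here refl
[]=⇒∈ (there p) = there ([]=⇒∈ p)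

∈⇒[]= : ∀ {x : A} → x ∈ r → ∃[ j ] r [ j ]= x
∈⇒[]= (here refl) = 0 , here
∈⇒[]= (there p)   = Product.map suc there (∈⇒[]= p)

[]=-ext : ∀ (r s : List A) → (∀ {j x} → r [ j ]= x → s [ j ]= x) →
          (∀ {j x} → s [ j ]= x → r [ j ]= x) → r ≡ s
[]=-ext []      []      _ _ = refl
[]=-ext []      (_ ∷ _) _ g with () ← g here
[]=-ext (_ ∷ _) []      f _ with () ← f here
[]=-ext (x ∷ r) (y ∷ s) f g with here ← f here =
  cong (x ∷_) ([]=-ext r s (λ p → there⁻ (f (there p))) (λ p → there⁻ (g (there p))))

_[_][_]=_ : List (List A) → ℕ → ℕ → A → Set
T [ i ][ j ]= x = ∃[ r ] (T [ i ]= r × r [ j ]= x)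

cell-here : ∀ {x : A} → r [ j ]= x → (r ∷ T) [ 0 ][ j ]= x
cell-here p = _ , here , p

cell-here⁻ : ∀ {x : A} → (r ∷ T) [ 0 ][ j ]= x → r [ j ]= x
cell-here⁻ (_ , here , p) = p

cell-there : ∀ {x : A} → T [ i ][ j ]= x → (r ∷ T) [ suc i ][ j ]= x
cell-there (s , q , p) = s , there q , p

cell-there⁻ : ∀ {x : A} → (r ∷ T) [ suc i ][ j ]= x → T [ i ][ j ]= x
cell-there⁻ (s , there q , p) = s , q , p

cell-functional : ∀ {x y : A} → T [ i ][ j ]= x → T [ i ][ j ]= y → x ≡ y
cell-functional (_ , q , p) (_ , q′ , p′) with refl ← []=-functional q q′ = []=-functional p p′

cell⇒∈ : ∀ {x : A} → T [ i ][ j ]= x → x ∈ concat T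
cell⇒∈ (_ , q , p) = ∈-concat⁺′ ([]=⇒∈ p) ([]=⇒∈ q)

∈⇒cell : ∀ (T : List (List A)) {x} → x ∈ concat T → ∃[ i ] ∃[ j ] T [ i ][ j ]= x
∈⇒cell T x∈T =
  let r , x∈r , r∈T = ∈-concat⁻′ T x∈T
      j , p = ∈⇒[]= x∈r
      i , q = ∈⇒[]= r∈T
  in i , j , r , q , p

RowsNonempty : List (List A) → Set
RowsNonempty = All (λ r → 0 < length r)

cell-ext : ∀ (T U : List (List A)) → RowsNonempty T → RowsNonempty U →
           (∀ {i j x} → T [ i ][ j ]= x → U [ i ][ j ]= x) →
           (∀ {i j x} → U [ i ][ j ]= x → T [ i ][ j ]= x) → T ≡ U
cell-ext []            []            _          _          _ _ = refl
cell-ext []            ([] ∷ _)      _          (() ∷ _)   _ _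
cell-ext ([] ∷ _)      []            (() ∷ _)   _          _ _
cell-ext []            ((_ ∷ _) ∷ _) _          _          _ g with _ , () , _ ← g (cell-here here)
cell-ext ((_ ∷ _) ∷ _) []            _          _          f _ with _ , () , _ ← f (cell-here here)
cell-ext (r ∷ T)       (s ∷ U)       (_ ∷ neT) (_ ∷ neU) f g = cong₂ _∷_
  ([]=-ext r s (λ p → cell-here⁻ (f (cell-here p))) (λ p → cell-here⁻ (g (cell-here p))))
  (cell-ext T U neT neU (λ c → cell-there⁻ (f (cell-there c))) (λ c → cell-there⁻ (g (cell-there c))))

-- Transposition

zipCons : List A → List (List A) → List (List A)
zipCons []       cs       = cs
zipCons (x ∷ xs) []       = (x ∷ []) ∷ zipCons xs []
zipCons (x ∷ xs) (c ∷ cs) = (x ∷ c) ∷ zipCons xs cs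

transpose : List (List A) → List (List A)
transpose []       = []
transpose (r ∷ rs) = zipCons r (transpose rs)

NonincreasingLengths : List (List A) → Set
NonincreasingLengths = Linked (λ r s → length s ≤ length r)

length-zipCons : ∀ (r : List A) cs → length cs ≤ length r → length (zipCons r cs) ≡ length r
length-zipCons []      []       _          = refl
length-zipCons (_ ∷ r) []       _          = cong suc (length-zipCons r [] z≤n)
length-zipCons (_ ∷ r) (_ ∷ cs) (s≤s cs≤r) = cong suc (length-zipCons r cs cs≤r)

length-transpose-≤ : NonincreasingLengths (r ∷ T) → length (transpose T) ≤ length r
length-transpose : NonincreasingLengths (r ∷ T) → length (transpose (r ∷ T)) ≡ length r

length-transpose-≤ [-]          = z≤n
length-transpose-≤ (s≤r ∷ incr) = ≤-trans (≤-reflexive (length-transpose incr)) s≤r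

length-transpose {r = r} {T = T} incr = length-zipCons r (transpose T) (length-transpose-≤ incr)

zipCons-head : ∀ (r : List A) cs {x} → r [ j ]= x → zipCons r cs [ j ][ 0 ]= x
zipCons-head (_ ∷ _) []       here      = cell-here here
zipCons-head (_ ∷ _) (_ ∷ _)  here      = cell-here here
zipCons-head (_ ∷ r) []       (there p) = cell-there (zipCons-head r [] p)
zipCons-head (_ ∷ r) (_ ∷ cs) (there p) = cell-there (zipCons-head r cs p)

zipCons-tail : ∀ (r : List A) cs {x} → length cs ≤ length r →
               cs [ j ][ i ]= x → zipCons r cs [ j ][ suc i ]= x
zipCons-tail (_ ∷ _) (_ ∷ _)  _          (_ , here , p)    = cell-here (there p)
zipCons-tail (_ ∷ r) (_ ∷ cs) (s≤s cs≤r) (_ , there q , p) = cell-there (zipCons-tail r cs cs≤r (_ , q , p))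

zipCons-head⁻ : ∀ (r : List A) cs {x} → length cs ≤ length r →
                zipCons r cs [ j ][ 0 ]= x → r [ j ]= x
zipCons-head⁻ (_ ∷ _) []       _          (_ , here , here)  = here
zipCons-head⁻ (_ ∷ r) []       _          (_ , there q , p)  = there (zipCons-head⁻ r [] z≤n (_ , q , p))
zipCons-head⁻ (_ ∷ _) (_ ∷ _)  _          (_ , here , here)  = here
zipCons-head⁻ (_ ∷ r) (_ ∷ cs) (s≤s cs≤r) (_ , there q , p)  = there (zipCons-head⁻ r cs cs≤r (_ , q , p))

zipCons-tail⁻ : ∀ (r : List A) cs {x} → length cs ≤ length r →
                zipCons r cs [ j ][ suc i ]= x → cs [ j ][ i ]= x
zipCons-tail⁻ (_ ∷ _) []       _          (_ , here , there ())
zipCons-tail⁻ (_ ∷ r) []       _          (_ , there q , p)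
  with _ , () , _ ← zipCons-tail⁻ r [] z≤n (_ , q , p)
zipCons-tail⁻ (_ ∷ _) (_ ∷ _)  _          (_ , here , there p) = cell-here p
zipCons-tail⁻ (_ ∷ r) (_ ∷ cs) (s≤s cs≤r) (_ , there q , p)  = cell-there (zipCons-tail⁻ r cs cs≤r (_ , q , p))

transpose-cell⁺ : ∀ {x : A} → NonincreasingLengths T → T [ i ][ j ]= x → transpose T [ j ][ i ]= x
transpose-cell⁺ {T = r ∷ T} _    (_ , here , p)    = zipCons-head r (transpose T) p
transpose-cell⁺ {T = r ∷ T} incr (_ , there q , p) =
  zipCons-tail r (transpose T) (length-transpose-≤ incr) (transpose-cell⁺ (Linked.tail incr) (_ , q , p))

transpose-cell⁻ : ∀ {x : A} → NonincreasingLengths T → transpose T [ j ][ i ]= x → T [ i ][ j ]= x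
transpose-cell⁻ {T = r ∷ T} {i = zero}  incr c =
  cell-here (zipCons-head⁻ r (transpose T) (length-transpose-≤ incr) c)
transpose-cell⁻ {T = r ∷ T} {i = suc i} incr c =
  cell-there (transpose-cell⁻ (Linked.tail incr) (zipCons-tail⁻ r (transpose T) (length-transpose-≤ incr) c))

zipCons-nonempty : ∀ (r : List A) cs → RowsNonempty cs → RowsNonempty (zipCons r cs)
zipCons-nonempty []      cs       nonempty       = nonempty
zipCons-nonempty (_ ∷ r) []       _              = s≤s z≤n ∷ zipCons-nonempty r [] []
zipCons-nonempty (_ ∷ r) (_ ∷ cs) (_ ∷ nonempty) = s≤s z≤n ∷ zipCons-nonempty r cs nonempty

transpose-nonempty : ∀ (T : List (List A)) → RowsNonempty (transpose T)
transpose-nonempty []      = []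
transpose-nonempty (r ∷ T) = zipCons-nonempty r (transpose T) (transpose-nonempty T)

concat-zipCons : ∀ (r : List A) cs → concat (zipCons r cs) ↭ r ++ concat cs
concat-zipCons []      cs       = ↭-refl
concat-zipCons (x ∷ r) []       = prep x (concat-zipCons r [])
concat-zipCons (x ∷ r) (c ∷ cs) = prep x (↭-trans (++⁺ˡ c (concat-zipCons r cs)) (shifts c r))

concat-transpose : ∀ (T : List (List A)) → concat (transpose T) ↭ concat T
concat-transpose []      = ↭-refl
concat-transpose (r ∷ T) = ↭-trans (concat-zipCons r (transpose T)) (++⁺ˡ r (concat-transpose T))

length-concat-transpose : ∀ (T : List (List A)) → length (concat (transpose T)) ≡ length (concat T)
length-concat-transpose T = ↭-length (concat-transpose T)

Unique-resp-↭ : ∀ {xs ys : List A} → xs ↭ ys → Unique xs → Unique ys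
Unique-resp-↭ xs↭ys = PermutationSetoid.Unique-resp-↭ (setoid _) (↭⇒↭ₛ xs↭ys)

transpose-unique : ∀ (T : List (List A)) → Unique (concat T) → Unique (concat (transpose T))
transpose-unique T = Unique-resp-↭ (↭-sym (concat-transpose T))

lengthAt : List (List A) → ℕ → ℕ
lengthAt []      _       = 0
lengthAt (c ∷ _) zero    = length c
lengthAt (_ ∷ C) (suc j) = lengthAt C j

map-length-lengthAt : ∀ (C : List (List A)) → map length C ≡ applyUpTo (lengthAt C) (length C)
map-length-lengthAt []      = refl
map-length-lengthAt (c ∷ C) = cong (length c ∷_) (map-length-lengthAt C)

lengthAt-antitone⇒nonincreasing : ∀ (C : List (List A)) →
  (∀ j → lengthAt C (suc j) ≤ lengthAt C j) → NonincreasingLengths C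
lengthAt-antitone⇒nonincreasing []          _        = []
lengthAt-antitone⇒nonincreasing (_ ∷ [])    _        = [-]
lengthAt-antitone⇒nonincreasing (_ ∷ c ∷ C) antitone =
  antitone 0 ∷ lengthAt-antitone⇒nonincreasing (c ∷ C) (antitone ∘ suc)

-- The j-th part of conj μ (counting from 0) when j < μ₁.
countAbove : ℕ → List ℕ → ℕ
countAbove j μ = length (filter (λ x → suc j ≤? x) μ)

countAbove-∷ : ∀ j a μ → countAbove j (a ∷ μ) ≡ countAbove j (a ∷ []) + countAbove j μ
countAbove-∷ j a μ with j <ᵇ a
... | true  = refl
... | false = refl

countAbove-suc : ∀ j a → countAbove (suc j) (suc a ∷ []) ≡ countAbove j (a ∷ [])
countAbove-suc j a with j <ᵇ a
... | true  = refl
... | false = refl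

countAbove-≤1 : ∀ j a → countAbove j (a ∷ []) ≤ 1
countAbove-≤1 j a with j <ᵇ a
... | true  = ≤-refl
... | false = z≤n

countAbove-antitone : ∀ j μ → countAbove (suc j) μ ≤ countAbove j μ
countAbove-antitone j [] = z≤n
countAbove-antitone j (a ∷ μ) rewrite countAbove-∷ j a μ | countAbove-∷ (suc j) a μ =
  +-mono-≤ (singleton j a) (countAbove-antitone j μ)
  where
  singleton : ∀ j a → countAbove (suc j) (a ∷ []) ≤ countAbove j (a ∷ [])
  singleton j       zero    = z≤n
  singleton zero    (suc a) = countAbove-≤1 1 (suc a)
  singleton (suc j) (suc a) rewrite countAbove-suc (suc j) a | countAbove-suc j a = singleton j a

lengthAt-zipCons : ∀ (r : List A) cs j →
  lengthAt (zipCons r cs) j ≡ countAbove j (length r ∷ []) + lengthAt cs j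
lengthAt-zipCons []      cs       j       = refl
lengthAt-zipCons (_ ∷ r) []       zero    = refl
lengthAt-zipCons (_ ∷ r) (_ ∷ _)  zero    = refl
lengthAt-zipCons (_ ∷ r) []       (suc j) =
  trans (lengthAt-zipCons r [] j) (cong (_+ 0) (sym (countAbove-suc j (length r))))
lengthAt-zipCons (_ ∷ r) (_ ∷ cs) (suc j) =
  trans (lengthAt-zipCons r cs j) (cong (_+ lengthAt cs j) (sym (countAbove-suc j (length r))))

lengthAt-transpose : ∀ (T : List (List A)) j → lengthAt (transpose T) j ≡ countAbove j (map length T)
lengthAt-transpose []      j = refl
lengthAt-transpose (r ∷ T) j = begin
  lengthAt (zipCons r (transpose T)) j
    ≡⟨ lengthAt-zipCons r (transpose T) j ⟩
  countAbove j (length r ∷ []) + lengthAt (transpose T) j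
    ≡⟨ cong (countAbove j (length r ∷ []) +_) (lengthAt-transpose T j) ⟩
  countAbove j (length r ∷ []) + countAbove j (map length T)
    ≡⟨ countAbove-∷ j (length r) (map length T) ⟨
  countAbove j (map length (r ∷ T))
    ∎
  where open ≡-Reasoning

transpose-nonincreasing : ∀ (T : List (List A)) → NonincreasingLengths (transpose T)
transpose-nonincreasing T = lengthAt-antitone⇒nonincreasing (transpose T) λ j →
  subst₂ _≤_ (sym (lengthAt-transpose T (suc j))) (sym (lengthAt-transpose T j))
    (countAbove-antitone j (map length T))

shape-transpose : NonincreasingLengths T → map length (transpose T) ≡ conj (map length T)
shape-transpose {T = []}    _    = refl
shape-transpose {T = r ∷ T} incr = begin
  map length (transpose (r ∷ T))
    ≡⟨ map-length-lengthAt (transpose (r ∷ T)) ⟩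
  applyUpTo (lengthAt (transpose (r ∷ T))) (length (transpose (r ∷ T)))
    ≡⟨ cong (applyUpTo _) (length-transpose incr) ⟩
  applyUpTo (lengthAt (transpose (r ∷ T))) (length r)
    ≡⟨ map-upTo _ (length r) ⟨
  map (lengthAt (transpose (r ∷ T))) (upTo (length r))
    ≡⟨ map-cong (lengthAt-transpose (r ∷ T)) (upTo (length r)) ⟩
  conj (map length (r ∷ T))
    ∎
  where open ≡-Reasoning

transpose-involutive : NonincreasingLengths T → RowsNonempty T → transpose (transpose T) ≡ T
transpose-involutive {T = T} incr nonempty =
  cell-ext (transpose (transpose T)) T (transpose-nonempty (transpose T)) nonempty
    (λ c → transpose-cell⁻ incr (transpose-cell⁻ (transpose-nonincreasing T) c))
    (λ c → transpose-cell⁺ (transpose-nonincreasing T) (transpose-cell⁺ incr c))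

-- Conjugate partitions

sum-map-length : ∀ (C : List (List A)) → sum (map length C) ≡ length (concat C)
sum-map-length []      = refl
sum-map-length (c ∷ C) = trans (cong (length c +_) (sum-map-length C)) (sym (length-++ c))

-- Any filling of the diagram of μ has shape μ, so conj inherits the properties of transpose.
blank : List ℕ → List (List ⊤)
blank = map (λ a → replicate a tt)

map-length-blank : ∀ μ → map length (blank μ) ≡ μ
map-length-blank []      = refl
map-length-blank (a ∷ μ) = cong₂ _∷_ (length-replicate a) (map-length-blank μ)

blank-nonincreasing : ∀ {μ} → Linked _≥_ μ → NonincreasingLengths (blank μ)
blank-nonincreasing []                     = []
blank-nonincreasing [-]                    = [-]
blank-nonincreasing {a ∷ b ∷ _} (b≤a ∷ decr) =
  subst₂ _≤_ (sym (length-replicate b)) (sym (length-replicate a)) b≤a ∷ blank-nonincreasing decr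

blank-nonempty : ∀ {μ} → All (0 <_) μ → RowsNonempty (blank μ)
blank-nonempty []                    = []
blank-nonempty {a ∷ _} (0<a ∷ pos) = subst (0 <_) (sym (length-replicate a)) 0<a ∷ blank-nonempty pos

conj-blank : ∀ {μ} → Linked _≥_ μ → conj μ ≡ map length (transpose (blank μ))
conj-blank {μ} decr =
  trans (cong conj (sym (map-length-blank μ))) (sym (shape-transpose (blank-nonincreasing decr)))

conj-partition : ∀ {μ} → IsPartition μ → IsPartition (conj μ)
conj-partition {μ} (decr , _) rewrite conj-blank decr =
  LinkedP.map⁺ (transpose-nonincreasing (blank μ)) , AllP.map⁺ (transpose-nonempty (blank μ))

conj-involutive : ∀ {μ} → IsPartition μ → conj (conj μ) ≡ μ
conj-involutive {μ} (decr , pos) = begin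
  conj (conj μ)
    ≡⟨ cong conj (conj-blank decr) ⟩
  conj (map length (transpose (blank μ)))
    ≡⟨ shape-transpose (transpose-nonincreasing (blank μ)) ⟨
  map length (transpose (transpose (blank μ)))
    ≡⟨ cong (map length) (transpose-involutive (blank-nonincreasing decr) (blank-nonempty pos)) ⟩
  map length (blank μ)
    ≡⟨ map-length-blank μ ⟩
  μ ∎
  where open ≡-Reasoning

sum-conj : ∀ {μ} → Linked _≥_ μ → sum (conj μ) ≡ sum μ
sum-conj {μ} decr = begin
  sum (conj μ)                                 ≡⟨ cong sum (conj-blank decr) ⟩
  sum (map length (transpose (blank μ)))       ≡⟨ sum-map-length (transpose (blank μ)) ⟩
  length (concat (transpose (blank μ)))        ≡⟨ length-concat-transpose (blank μ) ⟩
  length (concat (blank μ))                    ≡⟨ sum-map-length (blank μ) ⟨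
  sum (map length (blank μ))                   ≡⟨ cong sum (map-length-blank μ) ⟩
  sum μ                                        ∎
  where open ≡-Reasoning

-- Strict rows and columns

RowStrict : List (List ℕ) → Set
RowStrict T = ∀ {i j x} → T [ i ][ suc j ]= x → ∃[ y ] (T [ i ][ j ]= y × y < x)

ColumnStrict : List (List ℕ) → Set
ColumnStrict T = ∀ {i j x} → T [ suc i ][ j ]= x → ∃[ y ] (T [ i ][ j ]= y × y < x)

Linked<⇒predecessor : ∀ {r x} → Linked _<_ r → r [ suc j ]= x → ∃[ y ] (r [ j ]= y × y < x)
Linked<⇒predecessor (y<x ∷ _)    (there here)      = _ , here , y<x
Linked<⇒predecessor (_ ∷ sorted) (there (there p)) = map₂ (map₁ there) (Linked<⇒predecessor sorted (there p))

predecessor⇒Linked< : ∀ r → (∀ {j x} → r [ suc j ]= x → ∃[ y ] (r [ j ]= y × y < x)) → Linked _<_ r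
predecessor⇒Linked< []          _    = []
predecessor⇒Linked< (_ ∷ [])    _    = [-]
predecessor⇒Linked< (a ∷ b ∷ r) pred =
  head (pred (there here)) ∷ predecessor⇒Linked< (b ∷ r) (λ p → map₂ (map₁ there⁻) (pred (there p)))
  where
  head : ∃[ y ] ((a ∷ b ∷ r) [ 0 ]= y × y < b) → a < b
  head (_ , here , a<b) = a<b

ColOK⇒above : ∀ {r s x} → ColOK r s → s [ j ]= x → ∃[ y ] (r [ j ]= y × y < x)
ColOK⇒above {r = a ∷ _} {_ ∷ _} (a<b , _)  here      = a , here , a<b
ColOK⇒above {r = _ ∷ _} {_ ∷ _} (_ , cols) (there p) = map₂ (map₁ there) (ColOK⇒above cols p)

above⇒ColOK : ∀ r s → (∀ {j x} → s [ j ]= x → ∃[ y ] (r [ j ]= y × y < x)) → ColOK r s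
above⇒ColOK r       []      _     = tt
above⇒ColOK []      (_ ∷ _) above with _ , () , _ ← above here
above⇒ColOK (_ ∷ r) (_ ∷ s) above with _ , here , a<b ← above here =
  a<b , above⇒ColOK r s (λ p → map₂ (map₁ there⁻) (above (there p)))

ColOK⇒length-≤ : ∀ r s → ColOK r s → length s ≤ length r
ColOK⇒length-≤ r       []      _          = z≤n
ColOK⇒length-≤ (_ ∷ r) (_ ∷ s) (_ , cols) = s≤s (ColOK⇒length-≤ r s cols)

colsInc⇒nonincreasing : Linked ColOK T → NonincreasingLengths T
colsInc⇒nonincreasing = Linked.map (λ {r} {s} → ColOK⇒length-≤ r s)

rowsInc⇒RowStrict : All (Linked _<_) T → RowStrict T
rowsInc⇒RowStrict rows (r , q , p) =
  map₂ (map₁ (λ p′ → r , q , p′)) (Linked<⇒predecessor (All.lookup rows ([]=⇒∈ q)) p)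

RowStrict⇒rowsInc : ∀ T → RowStrict T → All (Linked _<_) T
RowStrict⇒rowsInc []      _   = []
RowStrict⇒rowsInc (r ∷ T) row =
  predecessor⇒Linked< r (λ p → map₂ (map₁ cell-here⁻) (row (cell-here p)))
  ∷ RowStrict⇒rowsInc T (λ c → map₂ (map₁ cell-there⁻) (row (cell-there c)))

colsInc⇒ColumnStrict : Linked ColOK T → ColumnStrict T
colsInc⇒ColumnStrict (cols ∷ _)   (_ , there here , p)      = map₂ (map₁ cell-here) (ColOK⇒above cols p)
colsInc⇒ColumnStrict (_ ∷ colsInc) (s , there (there q) , p) =
  map₂ (map₁ cell-there) (colsInc⇒ColumnStrict colsInc (s , there q , p))

ColumnStrict⇒colsInc : ∀ T → ColumnStrict T → Linked ColOK T
ColumnStrict⇒colsInc []          _   = []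
ColumnStrict⇒colsInc (_ ∷ [])    _   = [-]
ColumnStrict⇒colsInc (r ∷ s ∷ T) col =
  above⇒ColOK r s (λ p → map₂ (map₁ cell-here⁻) (col (cell-there (cell-here p))))
  ∷ ColumnStrict⇒colsInc (s ∷ T) (λ c → map₂ (map₁ cell-there⁻) (col (cell-there c)))

transpose-ColumnStrict : NonincreasingLengths T → ColumnStrict T → RowStrict (transpose T)
transpose-ColumnStrict incr col c = map₂ (map₁ (transpose-cell⁺ incr)) (col (transpose-cell⁻ incr c))

transpose-RowStrict : NonincreasingLengths T → RowStrict T → ColumnStrict (transpose T)
transpose-RowStrict incr row c = map₂ (map₁ (transpose-cell⁺ incr)) (row (transpose-cell⁻ incr c))

-- C k x: the entry at position k of a row or column is x.
module Line (C : ℕ → ℕ → Set)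
  (predecessor : ∀ {k x} → C (suc k) x → ∃[ y ] (C k y × y < x))
  (functional : ∀ {k x y} → C k x → C k y → x ≡ y) where

  increasing : ∀ {k k′ x y} → k < k′ → C k x → C k′ y → x < y
  increasing {k′ = suc k′} k<k′ cx cy with predecessor cy | m<1+n⇒m<n∨m≡n k<k′
  ... | z , cz , z<y | inj₁ k<k′ = <-trans (increasing k<k′ cx cz) z<y
  ... | z , cz , z<y | inj₂ refl rewrite functional cx cz = z<y

  nondecreasing : ∀ {k k′ x y} → k ≤ k′ → C k x → C k′ y → x ≤ y
  nondecreasing k≤k′ cx cy with m≤n⇒m<n∨m≡n k≤k′
  ... | inj₁ k<k′ = <⇒≤ (increasing k<k′ cx cy)
  ... | inj₂ refl = ≤-reflexive (functional cx cy)

  downward-closed : ∀ {k k′ y} → k ≤ k′ → C k′ y → ∃[ x ] C k x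
  downward-closed {k′ = k′} {y} k≤k′ cy with m≤n⇒m<n∨m≡n k≤k′
  ... | inj₂ refl = y , cy
  downward-closed {k′ = suc k′} k≤k′ cy | inj₁ k<k′ =
    let _ , cz , _ = predecessor cy in downward-closed (s≤s⁻¹ k<k′) cz

module _ {T : List (List ℕ)} (row : RowStrict T) (col : ColumnStrict T) where
  private
    module Row (i : ℕ) = Line (λ j x → T [ i ][ j ]= x) row cell-functional
    module Column (j : ℕ) = Line (λ i x → T [ i ][ j ]= x) col cell-functional

  successor-not-southeast : ∀ {i j i′ j′ k} → T [ i ][ j ]= k → T [ i′ ][ j′ ]= suc k →
                            i < i′ → j < j′ → ⊥
  successor-not-southeast {j = j} {i′ = i′} c c′ i<i′ j<j′ =
    -- the entry y at (i′, j) would satisfy k < y < k + 1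
    let y , d = Row.downward-closed i′ (<⇒≤ j<j′) c′
    in <⇒≱ (Column.increasing j i<i′ c d) (s≤s⁻¹ (Row.increasing i′ j<j′ d c′))

  successor-not-northwest : ∀ {i j i′ j′ k} → T [ i ][ j ]= k → T [ i′ ][ j′ ]= suc k →
                            i′ ≤ i → j′ ≤ j → ⊥
  successor-not-northwest {i = i} {j′ = j′} c c′ i′≤i j′≤j =
    -- the entry y at (i, j′) would satisfy k + 1 ≤ y ≤ k
    let y , d = Row.downward-closed i j′≤j c
    in <⇒≱ (Column.nondecreasing j′ i′≤i c′ d) (Row.nondecreasing i j′≤j d c)

-- Descents

any-≟-∈ : ∀ {x} r → x ∈ r → any (λ y → ⌊ x ≟ y ⌋) r ≡ true
any-≟-∈ {x} (y ∷ r) x∈y∷r with x ≟ y | x∈y∷r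
... | yes _  | _         = refl
... | no x≢y | here x≡y  = contradiction x≡y x≢y
... | no _   | there x∈r = any-≟-∈ r x∈r

any-≟-∉ : ∀ {x} r → x ∉ r → any (λ y → ⌊ x ≟ y ⌋) r ≡ false
any-≟-∉ []      _   = refl
any-≟-∉ {x} (y ∷ r) x∉y∷r with x ≟ y
... | yes x≡y = contradiction (here x≡y) x∉y∷r
... | no _    = any-≟-∉ r (x∉y∷r ∘ there)

rowOf-here : ∀ {x} {r} {T} → x ∈ r → rowOf (r ∷ T) x ≡ 0
rowOf-here {r = r} x∈r rewrite any-≟-∈ r x∈r = refl

rowOf-there : ∀ {x} {r} {T} → x ∉ r → rowOf (r ∷ T) x ≡ suc (rowOf T x)
rowOf-there {r = r} x∉r rewrite any-≟-∉ r x∉r = refl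

Unique-++⁻ʳ : ∀ (xs : List A) {ys} → Unique (xs ++ ys) → Unique ys
Unique-++⁻ʳ []       unique       = unique
Unique-++⁻ʳ (_ ∷ xs) (_ ∷ unique) = Unique-++⁻ʳ xs unique

Unique-++-disjoint : ∀ (xs : List A) {ys x} → Unique (xs ++ ys) → x ∈ ys → x ∉ xs
Unique-++-disjoint (_ ∷ xs) (x≢ ∷ _)      x∈ys (here refl) = All.lookup x≢ (∈-++⁺ʳ xs x∈ys) refl
Unique-++-disjoint (_ ∷ xs) (_ ∷ unique) x∈ys (there x∈xs) = Unique-++-disjoint xs unique x∈ys x∈xs

rowOf-cell : ∀ {x} → Unique (concat T) → T [ i ][ j ]= x → rowOf T x ≡ i
rowOf-cell {T = r ∷ T} unique (_ , here , p)    = rowOf-here {T = T} ([]=⇒∈ p)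
rowOf-cell {T = r ∷ T} unique (s , there q , p) =
  trans (rowOf-there {T = T} (Unique-++-disjoint r unique (cell⇒∈ (s , q , p))))
        (cong suc (rowOf-cell (Unique-++⁻ʳ r unique) (s , q , p)))

setToComp-injective : ∀ {p D D′} n → Linked _≤_ (p ∷ D) → Linked _≤_ (p ∷ D′) →
                      setToComp p D n ≡ setToComp p D′ n → D ≡ D′
setToComp-injective {D = []}         {[]}         n _ _ _ = refl
setToComp-injective {D = []}         {_ ∷ []}     n _ _ ()
setToComp-injective {D = []}         {_ ∷ _ ∷ _}  n _ _ ()
setToComp-injective {D = _ ∷ []}     {[]}         n _ _ ()
setToComp-injective {D = _ ∷ _ ∷ _}  {[]}         n _ _ ()
setToComp-injective {D = d ∷ D} {d′ ∷ D′} n (p≤d ∷ sorted) (p≤d′ ∷ sorted′) eq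
  with ∷-injective eq
... | head-eq , tail-eq with refl ← ∸-cancelʳ-≡ p≤d p≤d′ head-eq =
  cong (d ∷_) (setToComp-injective n sorted sorted′ tail-eq)

positions : ℕ → List ℕ
positions n = map suc (upTo (n ∸ 1))

IsDescent : List (List ℕ) → ℕ → Set
IsDescent T k = rowOf T k < rowOf T (suc k)

descents : List (List ℕ) → ℕ → List ℕ
descents T n = filter (λ k → rowOf T k <? rowOf T (suc k)) (positions n)

0∷positions-sorted : ∀ n → Linked _≤_ (0 ∷ positions n)
0∷positions-sorted n rewrite map-upTo suc (n ∸ 1) = LinkedP.applyUpTo⁺₂ id (suc (n ∸ 1)) n≤1+n

com-descents : ∀ T {n} → size T ≡ n → com T ≡ setToComp 0 (descents T n) n
com-descents T refl = refl

descents-sorted : ∀ T n → Linked _≤_ (0 ∷ descents T n)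
descents-sorted T n = LinkedP.∷-filter⁺ _ ≤-trans (0∷positions-sorted n)

∈-positions⁻ : ∀ n → k ∈ positions n → ∃[ m ] (k ≡ suc m × suc m < n)
∈-positions⁻ (suc n) k∈ with m , m∈ , refl ← ∈-map⁻ suc k∈ = m , refl , s≤s (∈-upTo⁻ m∈)

module _ {P Q : A → Set} (P? : Decidable P) (Q? : Decidable Q) where
  open Equivalence

  filter-local-≐ : ∀ xs → (∀ {x} → x ∈ xs → P x ⇔ Q x) → filter P? xs ≡ filter Q? xs
  filter-local-≐ []       _   = refl
  filter-local-≐ (x ∷ xs) P⇔Q with P? x | Q? x
  ... | yes _  | yes _  = cong (x ∷_) (filter-local-≐ xs (P⇔Q ∘ there))
  ... | no _   | no _   = filter-local-≐ xs (P⇔Q ∘ there)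
  ... | yes px | no ¬qx = contradiction (to (P⇔Q (here refl)) px) ¬qx
  ... | no ¬px | yes qx = contradiction (from (P⇔Q (here refl)) qx) ¬px

  filter-≡⇒local-≐ : ∀ {xs} → filter P? xs ≡ filter Q? xs → ∀ {x} → x ∈ xs → P x ⇔ Q x
  filter-≡⇒local-≐ {xs} eq x∈ = mk⇔
    (λ px → proj₂ (∈-filter⁻ Q? {xs = xs} (subst (_ ∈_) eq (∈-filter⁺ P? x∈ px))))
    (λ qx → proj₂ (∈-filter⁻ P? {xs = xs} (subst (_ ∈_) (sym eq) (∈-filter⁺ Q? x∈ qx))))

¬-cong-⇔ : ∀ {P Q : Set} → P ⇔ Q → (¬ P) ⇔ (¬ Q)
¬-cong-⇔ P⇔Q = mk⇔ (λ ¬p q → ¬p (Equivalence.from P⇔Q q)) (λ ¬q p → ¬q (Equivalence.to P⇔Q p))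

descent-transpose-cells : ∀ {T i j i′ j′ k} → RowStrict T → ColumnStrict T → NonincreasingLengths T →
  Unique (concat T) → T [ i ][ j ]= k → T [ i′ ][ j′ ]= suc k →
  IsDescent (transpose T) k ⇔ (¬ IsDescent T k)
descent-transpose-cells {T} {i} {j} {i′} {j′} row col incr unique c c′
  rewrite rowOf-cell unique c | rowOf-cell unique c′
        | rowOf-cell (transpose-unique T unique) (transpose-cell⁺ incr c)
        | rowOf-cell (transpose-unique T unique) (transpose-cell⁺ incr c′) =
  mk⇔ (λ j<j′ i<i′ → successor-not-southeast row col c c′ i<i′ j<j′) right-of-unless-below
  where
  right-of-unless-below : ¬ i < i′ → j < j′
  right-of-unless-below ¬i<i′ with j <? j′
  ... | yes j<j′ = j<j′
  ... | no ¬j<j′ = contradiction (≮⇒≥ ¬j<j′) (successor-not-northwest row col c c′ (≮⇒≥ ¬i<i′))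

module _ {μ : List ℕ} {T : List (List ℕ)} (t : SYT μ T) where
  open SYT t

  SYT-nonincreasing : NonincreasingLengths T
  SYT-nonincreasing = colsInc⇒nonincreasing colsInc

  SYT-unique : Unique (concat T)
  SYT-unique = Unique-resp-↭ (↭-sym entries) (UniqueP.map⁺ suc-injective (UniqueP.upTo⁺ (sum μ)))

  SYT-size : size T ≡ sum μ
  SYT-size = trans (sym (sum-map-length T)) (cong sum shape)

  SYT-size-transpose : size (transpose T) ≡ sum μ
  SYT-size-transpose = trans (length-concat-transpose T) SYT-size

  SYT-∋ : ∀ {m} → m < sum μ → suc m ∈ concat T
  SYT-∋ m<n = ∈-resp-↭ (↭-sym entries) (∈-map⁺ suc (∈-upTo⁺ m<n))

  SYT-descent-transpose : k ∈ positions (sum μ) → IsDescent (transpose T) k ⇔ (¬ IsDescent T k)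
  SYT-descent-transpose k∈ with m , refl , 1+m<n ← ∈-positions⁻ (sum μ) k∈ =
    let _ , _ , c  = ∈⇒cell T (SYT-∋ (<-trans (n<1+n m) 1+m<n))
        _ , _ , c′ = ∈⇒cell T (SYT-∋ 1+m<n)
    in descent-transpose-cells (rowsInc⇒RowStrict rowsInc) (colsInc⇒ColumnStrict colsInc)
         SYT-nonincreasing SYT-unique c c′

  SYT-shape-decreasing : Linked _≥_ μ
  SYT-shape-decreasing = subst (Linked _≥_) shape (LinkedP.map⁺ SYT-nonincreasing)

  SYT-transpose : SYT (conj μ) (transpose T)
  SYT-transpose = record
    { shape   = trans (shape-transpose SYT-nonincreasing) (cong conj shape)
    ; rowsInc = RowStrict⇒rowsInc _
        (transpose-ColumnStrict SYT-nonincreasing (colsInc⇒ColumnStrict colsInc))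
    ; colsInc = ColumnStrict⇒colsInc _
        (transpose-RowStrict SYT-nonincreasing (rowsInc⇒RowStrict rowsInc))
    ; entries = subst (λ n → concat (transpose T) ↭ map suc (upTo n)) (sym (sum-conj SYT-shape-decreasing))
        (↭-trans (concat-transpose T) entries)
    }

  SYT-transpose-involutive : All (0 <_) μ → transpose (transpose T) ≡ T
  SYT-transpose-involutive positive =
    transpose-involutive SYT-nonincreasing (AllP.map⁻ (subst (All (0 <_)) (sym shape) positive))

com-transpose : ∀ {μ T T′} → SYT μ T → SYT μ T′ → com T ≡ com T′ → com (transpose T) ≡ com (transpose T′)
com-transpose {μ} {T} {T′} t t′ eq = begin
  com (transpose T)                         ≡⟨ com-descents (transpose T) (SYT-size-transpose t) ⟩
  setToComp 0 (descents (transpose T) n) n  ≡⟨ cong (λ D → setToComp 0 D n) same-descentsᵗ ⟩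
  setToComp 0 (descents (transpose T′) n) n ≡⟨ com-descents (transpose T′) (SYT-size-transpose t′) ⟨
  com (transpose T′)                        ∎
  where
  open ≡-Reasoning
  n = sum μ
  same-descents : descents T n ≡ descents T′ n
  same-descents = setToComp-injective n (descents-sorted T n) (descents-sorted T′ n)
    (trans (sym (com-descents T (SYT-size t))) (trans eq (com-descents T′ (SYT-size t′))))
  same-descentsᵗ : descents (transpose T) n ≡ descents (transpose T′) n
  same-descentsᵗ = filter-local-≐ _ _ (positions n) λ k∈ →
    ⇔.trans (SYT-descent-transpose t k∈)
      (⇔.trans (¬-cong-⇔ (filter-≡⇒local-≐ _ _ same-descents k∈)) (⇔.sym (SYT-descent-transpose t′ k∈)))

FMultFree-conj⇒FMultFree : ∀ {μ} → All (0 <_) μ → FMultFree (conj μ) → FMultFree μ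
FMultFree-conj⇒FMultFree positive free _ T T′ t t′ refl com-eq = begin
  T                        ≡⟨ SYT-transpose-involutive t positive ⟨
  transpose (transpose T)  ≡⟨ cong transpose transposes-equal ⟩
  transpose (transpose T′) ≡⟨ SYT-transpose-involutive t′ positive ⟩
  T′                       ∎
  where
  open ≡-Reasoning
  transposes-equal : transpose T ≡ transpose T′
  transposes-equal = free _ _ _ (SYT-transpose t) (SYT-transpose t′) refl (com-transpose t′ t com-eq)

lemma3p1 : (λs : List ℕ) → IsPartition λs → (FMultFree λs ⇔ FMultFree (conj λs))
lemma3p1 λs λs-partition = mk⇔
  (λ free → FMultFree-conj⇒FMultFree (proj₂ (conj-partition λs-partition))
              (subst FMultFree (sym (conj-involutive λs-partition)) free))
  (FMultFree-conj⇒FMultFree (proj₂ λs-partition))
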